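{- The map $\sigma\mapsto(R(\sigma),S(\sigma))$ (Extended Patience Sorting) is a bijection from $\mathfrak{S}_n$ onto the set $\Sigma(n)$ of all ordered pairs $(R,S)$ of pile configurations on $[n]$ such that $\mathrm{sh}(R)=\mathrm{sh}(S)$ and the pair $(RPW(R),RPW(S'))$ avoids simultaneous occurrences of the pairs of patterns $(31\mathrm{ - }2,13\mathrm{ - }2)$, $(31\mathrm{ - }2,32\mathrm{ - }1)$ and $(32\mathrm{ - }1,13\mathrm{ - }2)$ at the same positions.
   Context: Extended Patience Sorting: given $\sigma=\sigma_1\cdots\sigma_n\in\mathfrak{S}_n$, process $\sigma_1,\dots,\sigma_n$ in order, maintaining left-to-right insertion piles $r_1,r_2,\dots$ and recording piles $s_1,s_2,\dots$. $\sigma_1$ starts pile $r_1$ and $s_1=\{1\}$. For $i\ge2$, if some pile has top card larger than $\sigma_i$, place $\sigma_i$ on top of the leftmost such pile $r_j$ and add $i$ to $s_j$; otherwise start a new pile $r_{k+1}=\{\sigma_i\}$ to the right and set $s_{k+1}=\{i\}$. Thus $R(\sigma)=(r_1,\dots,r_m)$ and $S(\sigma)=(s_1,\dots,s_m)$, where $s_j$ is the set of positions of the cards in $r_j$. A pile configuration on $[n]$ is any sequence of sets $R(\tau)$, $\tau\in\mathfrak{S}_n$ (each pile is regarded with its elements decreasing from bottom to top). The shape $\mathrm{sh}(R)=(|r_1|,\dots,|r_m|)$. For a pile configuration $R=(r_1,\dots,r_m)$, $RPW(R)$ is the word obtained by concatenating $r_1,\dots,r_m$, each written in decreasing order; for $S=(s_1,\dots,s_m)$,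 $RPW(S')$ is the word obtained by concatenating $s_1,\dots,s_m$, each written in increasing order. For words $u,v$ of length $n$ and patterns $p,q\in\{31\mathrm{ - }2,13\mathrm{ - }2,32\mathrm{ - }1\}$ (where $31\mathrm{ - }2$ means a subsequence $u_a u_{a+1} u_c$, $a+1<c$, order-isomorphic to $312$; similarly $13\mathrm{ - }2$ for $132$ and $32\mathrm{ - }1$ for $321$), $(u,v)$ has a simultaneous occurrence of $(p,q)$ at the same positions if there are $a<a+1<c$ such that $u_au_{a+1}u_c$ is an occurrence of $p$ and $v_av_{a+1}v_c$ is an occurrence of $q$; avoiding means no such positions exist. -}

module Defs where

open import Data.Nat using (ℕ; zero; suc; _<_; _<ᵇ_)
open import Data.Bool using (if_then_else_)
open import Data.List using (List; []; _∷_; [_]; _++_; map; concat; reverse; upTo; length)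
open import Data.Product using (_×_; _,_; proj₁; proj₂; ∃; ∃-syntax; Σ-syntax)
open import Relation.Binary.PropositionalEquality using (_≡_)
open import Relation.Nullary using (¬_)
open import Data.List.Relation.Binary.Permutation.Propositional using (_↭_)

[1…_] : ℕ → List ℕ
[1… n ] = map suc (upTo n)

-- σ ∈ 𝔖_n : σ is a word (one-line notation) that is a rearrangement of 1..n
IsPerm : ℕ → List ℕ → Set
IsPerm n σ = σ ↭ [1… n ]

-- A pile is stored as a list from bottom to top; top = last element.
-- (0 is returned only for the empty list, which never occurs as a pile.)
top : List ℕ → ℕ
top []           = 0
top (x ∷ [])     = x
top (x ∷ y ∷ xs) = top (y ∷ xs)

-- Each entry is (insertion pile r_j , recording pile s_j).
place : ℕ → ℕ → List (List ℕ × List ℕ) → List (List ℕ × List ℕ)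
place x i [] = [ ([ x ] , [ i ]) ]
place x i ((r , s) ∷ ps) =
  if x <ᵇ top r then (r ++ [ x ] , s ++ [ i ]) ∷ ps
                else (r , s) ∷ place x i ps

-- process σ_i, σ_{i+1}, ... where the current card has position i (1-based)
run : ℕ → List ℕ → List (List ℕ × List ℕ) → List (List ℕ × List ℕ)
run i []       ps = ps
run i (x ∷ xs) ps = run (suc i) xs (place x i ps)

eps : List ℕ → List (List ℕ × List ℕ)
eps σ = run 1 σ []

-- Pile configurations: each pile r_j is written with its elements in
-- decreasing order (bottom to top), i.e. as a set regarded decreasingly.
PileConf : Set
PileConf = List (List ℕ)

R : List ℕ → PileConf
R σ = map proj₁ (eps σ)

-- S(σ): the recording piles, regarded as sets, written decreasingly
-- (the positions were recorded in increasing order, so we reverse).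
S : List ℕ → PileConf
S σ = map (λ p → reverse (proj₂ p)) (eps σ)

IsPileConf : ℕ → PileConf → Set
IsPileConf n P = ∃[ τ ] (IsPerm n τ × R τ ≡ P)

sh : PileConf → List ℕ
sh P = map length P

RPW : PileConf → List ℕ
RPW P = concat P

-- RPW(S'): concatenate piles, each in increasing order
RPW′ : PileConf → List ℕ
RPW′ P = concat (map reverse P)

-- patterns, as relations on the three letters u_a u_{a+1} u_c
Pattern : Set₁
Pattern = ℕ → ℕ → ℕ → Set

p31-2 : Pattern
p31-2 x y z = (y < z) × (z < x)

p13-2 : Pattern
p13-2 x y z = (x < z) × (z < y)

p32-1 : Pattern
p32-1 x y z = (z < y) × (y < x)

-- letter at 0-based position k (default 0 out of range; guarded below)
at : List ℕ → ℕ → ℕ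
at []       k       = 0
at (x ∷ xs) zero    = x
at (x ∷ xs) (suc k) = at xs k

-- simultaneous occurrence of (p , q) in (u , v) at the same positions a, a+1, c
-- (0-based) with a + 1 < c, all positions inside both words
SimOcc : Pattern → Pattern → List ℕ → List ℕ → Set
SimOcc p q u v =
  Σ[ a ∈ ℕ ] Σ[ c ∈ ℕ ]
    (suc a < c) × (c < length u) × (c < length v)
    × p (at u a) (at u (suc a)) (at u c)
    × q (at v a) (at v (suc a)) (at v c)

Avoids : Pattern → Pattern → List ℕ → List ℕ → Set
Avoids p q u v = ¬ SimOcc p q u v

InΣ : ℕ → PileConf → PileConf → Set
InΣ n Rc Sc =
  IsPileConf n Rc × IsPileConf n Sc × (sh Rc ≡ sh Sc)
  × Avoids p31-2 p13-2 (RPW Rc) (RPW′ Sc)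
  × Avoids p31-2 p32-1 (RPW Rc) (RPW′ Sc)
  × Avoids p32-1 p13-2 (RPW Rc) (RPW′ Sc)

-- Deal σ as cards (value, position).  The card piles produced satisfy an invariant: along a pile
-- values decrease and positions increase, and for piles P left of P′ the top of P is smaller, P was
-- started earlier, and every card e of P′ dealt between two adjacent cards c, d of P exceeds c
-- (e was dealt while c was the top of P).  R σ and S σ are the two projections of the card piles,
-- so they determine them.  The invariant forbids the three pattern pairs in the reading words;
-- conversely, for pile configurations of equal shape, avoidance of (31-2, 13-2) and (32-1, 13-2)
-- yields the interlacing condition, hence the whole invariant.  Card piles with the invariant and
-- positions 1, …, n all arise by dealing: the card with position n is a top card, removing it keeps
-- the invariant, and dealing it again restores the piles.  Injectivity holds because inserting a
-- card with a given position into piles of earlier cards is injective.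

module Submission where

open import Defs
open import Data.Bool using (true; false; if_then_else_)
open import Data.Empty using (⊥-elim)
open import Data.Nat using (ℕ; zero; suc; _+_; _<_; _>_; _≤_; _<ᵇ_; s≤s; z≤n)
open import Data.Nat.Properties
  using (<-trans; <-asym; <-irrefl; <-≤-trans; ≤-<-trans; <⇒≤; ≤-refl; ≤∧≢⇒<; ≮⇒≥; <-cmp;
         <ᵇ-reflects-<; suc-injective; 0≢1+n; +-identityʳ; +-suc)
open import Data.Product using (_×_; _,_; proj₁; proj₂; ∃-syntax; <_,_>; uncurry)
open import Data.Sum using (_⊎_; inj₁; inj₂)
open import Data.List
  using (List; []; _∷_; [_]; _++_; _∷ʳ_; map; concat; reverse; upTo; length; zip; zipWith; _∷ʳ′_; initLast)
open import Data.List.Properties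
  using (map-++; map-∘; map-cong; upTo-∷ʳ; length-map; length-upTo; ++-assoc; ++-identityʳ; length-++-comm;
         concat-map; concat-++; unfold-reverse; reverse-involutive; length-reverse; ∷-injective; ∷ʳ-injective)
open import Data.List.Reverse using (Reverse; []; _∶_∶ʳ_; reverseView)
open import Data.List.Relation.Unary.All as All using (All; []; _∷_)
import Data.List.Relation.Unary.All.Properties as All
open import Data.List.Relation.Unary.AllPairs as AllPairs using (AllPairs; []; _∷_)
import Data.List.Relation.Unary.AllPairs.Properties as AllPairs
open import Data.List.Relation.Unary.Any using (here; there)
open import Data.List.Relation.Unary.Unique.Propositional using (Unique)
import Data.List.Relation.Unary.Unique.Propositional.Properties as Unique
open import Data.List.Membership.Propositional using (_∈_; _∉_)
open import Data.List.Membership.Propositional.Properties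
  using (∈-map⁺; ∈-map⁻; ∈-++⁺ˡ; ∈-++⁺ʳ; ∈-++⁻; ∈-concat⁺′; ∈-concat⁻′; ∈-∃++)
open import Data.List.Relation.Binary.Permutation.Propositional
  using (_↭_; ↭-refl; ↭-sym; ↭-trans; ↭⇒↭ₛ; module PermutationReasoning)
open import Data.List.Relation.Binary.Permutation.Propositional.Properties
  using (↭-length; ↭-empty-inv; ∈-resp-↭; All-resp-↭; ↭-reverse; shift; ++⁺ˡ; ++-comm; drop-∷)
  renaming (map⁺ to ↭-map⁺; ++⁺ to ↭-++⁺)
import Data.List.Relation.Binary.Permutation.Setoid.Properties as Permutationₛ
open import Relation.Binary.Definitions using (tri<; tri≈; tri>)
open import Relation.Binary.PropositionalEquality
  using (_≡_; _≢_; refl; sym; trans; cong; cong₂; subst; subst₂; module ≡-Reasoning)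
open import Relation.Binary.PropositionalEquality.Properties using (setoid)
open import Relation.Nullary using (¬_)
open import Relation.Nullary.Reflects using (ofʸ; ofⁿ)
open import Function using (_∘_; id)

unique-resp-↭ : {xs ys : List ℕ} → xs ↭ ys → Unique xs → Unique ys
unique-resp-↭ p = Permutationₛ.Unique-resp-↭ (setoid ℕ) (↭⇒↭ₛ p)

[1…]-∷ʳ : ∀ n → [1… suc n ] ≡ [1… n ] ∷ʳ suc n
[1…]-∷ʳ n = begin
  map suc (upTo (suc n))     ≡⟨ cong (map suc) (sym (upTo-∷ʳ n)) ⟩
  map suc (upTo n ∷ʳ n)      ≡⟨ map-++ suc (upTo n) [ n ] ⟩
  [1… n ] ∷ʳ suc n           ∎
  where open ≡-Reasoning

length-[1…] : ∀ n → length [1… n ] ≡ n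
length-[1…] n = trans (length-map suc (upTo n)) (length-upTo n)

unique-[1…] : ∀ n → Unique [1… n ]
unique-[1…] n = Unique.map⁺ suc-injective (Unique.upTo⁺ n)

∈-[1…]⇒≤ : ∀ {t n} → t ∈ [1… n ] → t ≤ n
∈-[1…]⇒≤ {n = n} t∈ with ∈-map⁻ suc t∈
... | u , u∈ , refl = All.lookup (All.all-upTo n) u∈

map-≢-[] : ∀ {A B : Set} {f : A → B} {xs} → xs ≢ [] → map f xs ≢ []
map-≢-[] {xs = []}    xs≢[] _ = xs≢[] refl
map-≢-[] {xs = _ ∷ _} _     ()

∷ʳ-≢-[] : ∀ {A : Set} (xs : List A) x → xs ∷ʳ x ≢ []
∷ʳ-≢-[] []      x ()
∷ʳ-≢-[] (_ ∷ _) x ()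

reverse-≢-[] : ∀ {A : Set} {xs : List A} → xs ≢ [] → reverse xs ≢ []
reverse-≢-[] {xs = []}     xs≢[] = ⊥-elim (xs≢[] refl)
reverse-≢-[] {xs = x ∷ xs} _ rewrite unfold-reverse x xs = ∷ʳ-≢-[] (reverse xs) x

concat-middle : ∀ {A : Set} (xss : List (List A)) ys zss → concat (xss ++ ys ∷ zss) ≡ concat xss ++ ys ++ concat zss
concat-middle xss ys zss = sym (concat-++ xss (ys ∷ zss))

concat-middle-∷ʳ : ∀ {A : Set} (xss : List (List A)) ys z zss →
  concat (xss ++ (ys ∷ʳ z) ∷ zss) ↭ z ∷ concat (xss ++ ys ∷ zss)
concat-middle-∷ʳ xss ys z zss = begin
  concat (xss ++ (ys ∷ʳ z) ∷ zss)         ≡⟨ concat-middle xss (ys ∷ʳ z) zss ⟩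
  concat xss ++ (ys ∷ʳ z) ++ concat zss   ≡⟨ cong (concat xss ++_) (++-assoc ys [ z ] (concat zss)) ⟩
  concat xss ++ ys ++ z ∷ concat zss      ↭⟨ ++⁺ˡ (concat xss) (shift z ys (concat zss)) ⟩
  concat xss ++ z ∷ ys ++ concat zss      ↭⟨ shift z (concat xss) (ys ++ concat zss) ⟩
  z ∷ concat xss ++ ys ++ concat zss      ≡⟨ cong (z ∷_) (concat-middle xss ys zss) ⟨
  z ∷ concat (xss ++ ys ∷ zss)            ∎
  where open PermutationReasoning

module _ {A : Set} where

  data Adjacent (x y : A) : List A → Set where
    here  : ∀ {zs} → Adjacent x y (x ∷ y ∷ zs)
    there : ∀ {w zs} → Adjacent x y zs → Adjacent x y (w ∷ zs)

  -- x y adjacent and z later: the position pattern of an occurrence of a pattern ab-c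
  data Occurs (x y z : A) : List A → Set where
    here  : ∀ {zs} → z ∈ zs → Occurs x y z (x ∷ y ∷ zs)
    there : ∀ {w zs} → Occurs x y z zs → Occurs x y z (w ∷ zs)

  adjacent-∈ : ∀ {x y xs} → Adjacent x y xs → x ∈ xs × y ∈ xs
  adjacent-∈ here      = here refl , there (here refl)
  adjacent-∈ (there a) with adjacent-∈ a
  ... | x∈ , y∈ = there x∈ , there y∈

  adjacent-allPairs : ∀ {R : A → A → Set} {x y xs} → Adjacent x y xs → AllPairs R xs → R x y
  adjacent-allPairs here      ((rxy ∷ _) ∷ _) = rxy
  adjacent-allPairs (there a) (_ ∷ rs)       = adjacent-allPairs a rs

  adjacent-++⁺ˡ : ∀ {x y xs} ys → Adjacent x y xs → Adjacent x y (xs ++ ys)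
  adjacent-++⁺ˡ ys here      = here
  adjacent-++⁺ˡ ys (there a) = there (adjacent-++⁺ˡ ys a)

  adjacent-∷ʳ∷ʳ : ∀ {x y} xs → Adjacent x y (xs ∷ʳ x ∷ʳ y)
  adjacent-∷ʳ∷ʳ []       = here
  adjacent-∷ʳ∷ʳ (w ∷ xs) = there (adjacent-∷ʳ∷ʳ xs)

  adjacent-∷ʳ⁻ : ∀ {x y z} xs → Adjacent x y (xs ∷ʳ z) → Adjacent x y xs ⊎ (∃[ ws ] xs ≡ ws ∷ʳ x × y ≡ z)
  adjacent-∷ʳ⁻ []           (there ())
  adjacent-∷ʳ⁻ (x ∷ [])     here      = inj₂ ([] , refl , refl)
  adjacent-∷ʳ⁻ (x ∷ y ∷ xs) here      = inj₁ here
  adjacent-∷ʳ⁻ (w ∷ xs)     (there a) with adjacent-∷ʳ⁻ xs a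
  ... | inj₁ a′               = inj₁ (there a′)
  ... | inj₂ (ws , refl , y≡z) = inj₂ (w ∷ ws , refl , y≡z)

  occurs-allPairs : ∀ {R : A → A → Set} {x y z xs} → Occurs x y z xs → AllPairs R xs → R x y × R y z
  occurs-allPairs (here z∈) ((rxy ∷ _) ∷ ry ∷ _) = rxy , All.lookup ry z∈
  occurs-allPairs (there o) (_ ∷ rs)             = occurs-allPairs o rs

  occurs-allPairs-last : ∀ {R : A → A → Set} {x y z xs} → Occurs x y z xs → AllPairs R xs → R x z × R y z
  occurs-allPairs-last (here z∈) ((_ ∷ rx) ∷ ry ∷ _) = All.lookup rx z∈ , All.lookup ry z∈
  occurs-allPairs-last (there o) (_ ∷ rs)             = occurs-allPairs-last o rs

  adjacent⇒occurs : ∀ {x y z xs ys} → Adjacent x y xs → z ∈ ys → Occurs x y z (xs ++ ys)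
  adjacent⇒occurs {xs = _ ∷ _ ∷ xs} here z∈ = here (∈-++⁺ʳ xs z∈)
  adjacent⇒occurs (there a) z∈ = there (adjacent⇒occurs a z∈)

  occurs-++⁺ʳ : ∀ {x y z} xs {ys} → Occurs x y z ys → Occurs x y z (xs ++ ys)
  occurs-++⁺ʳ []       o = o
  occurs-++⁺ʳ (w ∷ xs) o = there (occurs-++⁺ʳ xs o)

  occurs-++⁻ : ∀ {x y z} xs {ys} → Occurs x y z (xs ++ ys) →
    Occurs x y z xs ⊎ (Adjacent x y xs × z ∈ ys) ⊎ ((∃[ ws ] xs ≡ ws ∷ʳ x) × y ∈ ys) ⊎ Occurs x y z ys
  occurs-++⁻ []           o         = inj₂ (inj₂ (inj₂ o))
  occurs-++⁻ (x ∷ [])     (here _)  = inj₂ (inj₂ (inj₁ (([] , refl) , here refl)))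
  occurs-++⁻ (x ∷ y ∷ xs) (here z∈) with ∈-++⁻ xs z∈
  ... | inj₁ z∈xs = inj₁ (here z∈xs)
  ... | inj₂ z∈ys = inj₂ (inj₁ (here , z∈ys))
  occurs-++⁻ (w ∷ xs)     (there o) with occurs-++⁻ xs o
  ... | inj₁ o′                              = inj₁ (there o′)
  ... | inj₂ (inj₁ (adj , z∈))               = inj₂ (inj₁ (there adj , z∈))
  ... | inj₂ (inj₂ (inj₁ ((ws , refl) , y∈))) = inj₂ (inj₂ (inj₁ ((w ∷ ws , refl) , y∈)))
  ... | inj₂ (inj₂ (inj₂ o′))                = inj₂ (inj₂ (inj₂ o′))

  allPairs-++⁻ : ∀ {R : A → A → Set} xs {ys} → AllPairs R (xs ++ ys) →
    AllPairs R xs × AllPairs R ys × All (λ x → All (R x) ys) xs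
  allPairs-++⁻ []       rs       = [] , rs , []
  allPairs-++⁻ (x ∷ xs) (r ∷ rs) with allPairs-++⁻ xs rs
  ... | rxs , rys , rxys = All.++⁻ˡ xs r ∷ rxs , rys , All.++⁻ʳ xs r ∷ rxys

  allPairs-∷ʳ⁺ : ∀ {R : A → A → Set} {xs x} → AllPairs R xs → All (λ y → R y x) xs → AllPairs R (xs ∷ʳ x)
  allPairs-∷ʳ⁺ rs r = AllPairs.++⁺ rs ([] ∷ []) (All.map (_∷ []) r)

  allPairs-∷ʳ⁻ : ∀ {R : A → A → Set} xs {x} → AllPairs R (xs ∷ʳ x) → All (λ y → R y x) xs
  allPairs-∷ʳ⁻ xs rs = All.map All.head (proj₂ (proj₂ (allPairs-++⁻ xs rs)))

  allPairs-reverse : ∀ {R : A → A → Set} {xs} → AllPairs R xs → AllPairs (λ x y → R y x) (reverse xs)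
  allPairs-reverse []                 = []
  allPairs-reverse {xs = x ∷ xs} (r ∷ rs) rewrite unfold-reverse x xs =
    allPairs-∷ʳ⁺ (allPairs-reverse rs) (All-resp-↭ (↭-sym (↭-reverse xs)) r)

  allPairs-zipWith-All : ∀ {Pr : A → Set} {R R′ : A → A → Set} →
    (∀ {x y} → Pr x → Pr y → R x y → R′ x y) → ∀ {xs} → All Pr xs → AllPairs R xs → AllPairs R′ xs
  allPairs-zipWith-All f []         []       = []
  allPairs-zipWith-All f (px ∷ pxs) (r ∷ rs) =
    All.zipWith (λ (py , rxy) → f px py rxy) (pxs , r) ∷ allPairs-zipWith-All f pxs rs

  allPairs-replace : ∀ {R : A → A → Set} xs {y y′ zs} → AllPairs R (xs ++ y ∷ zs) →
    All (λ x → R x y → R x y′) xs → All (λ z → R y z → R y′ z) zs → AllPairs R (xs ++ y′ ∷ zs)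
  allPairs-replace []       (ry ∷ rs) _          fz = All.zipWith (λ (f , r) → f r) (fz , ry) ∷ rs
  allPairs-replace (x ∷ xs) (rx ∷ rs) (fx ∷ fxs) fz =
    All.++⁺ (All.++⁻ˡ xs rx) (fx (All.head (All.++⁻ʳ xs rx)) ∷ All.tail (All.++⁻ʳ xs rx)) ∷ allPairs-replace xs rs fxs fz

top-∷ʳ : ∀ xs x → top (xs ∷ʳ x) ≡ x
top-∷ʳ []           x = refl
top-∷ʳ (_ ∷ [])     x = refl
top-∷ʳ (_ ∷ y ∷ xs) x = top-∷ʳ (y ∷ xs) x

top-≤ : ∀ {r v} → r ≢ [] → AllPairs _>_ r → v ∈ r → top r ≤ v
top-≤ {r} r≢[] dec v∈ with initLast r
... | []      = ⊥-elim (r≢[] refl)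
... | A ∷ʳ′ a rewrite top-∷ʳ A a with ∈-++⁻ A v∈
...   | inj₂ (here refl) = ≤-refl
...   | inj₁ v∈A         = <⇒≤ (All.lookup (allPairs-∷ʳ⁻ A dec) v∈A)

-- Patience sorting on cards

Card : Set
Card = ℕ × ℕ

value time : Card → ℕ
value = proj₁
time  = proj₂

Pile Piles : Set
Pile  = List Card
Piles = List Pile

topValue : Pile → ℕ
topValue P = top (map value P)

topValue-∷ʳ : ∀ P c → topValue (P ∷ʳ c) ≡ value c
topValue-∷ʳ P c rewrite map-++ value P [ c ] = top-∷ʳ (map value P) (value c)

insert : Card → Piles → Piles
insert c []      = [ [ c ] ]
insert c (P ∷ Q) =
  if value c <ᵇ topValue P then (P ∷ʳ c) ∷ Q else P ∷ insert c Q

deal : ℕ → List ℕ → Piles → Piles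
deal i []       Q = Q
deal i (x ∷ xs) Q = deal (suc i) xs (insert (x , i) Q)

patience : List ℕ → Piles
patience σ = deal 1 σ []

insertionPiles recordingPiles : Piles → PileConf
insertionPiles = map (map value)
recordingPiles = map (reverse ∘ map time)

forgetCards : Piles → List (List ℕ × List ℕ)
forgetCards = map < map value , map time >

place-forgetCards : ∀ x i Q → place x i (forgetCards Q) ≡ forgetCards (insert (x , i) Q)
place-forgetCards x i []      = refl
place-forgetCards x i (P ∷ Q) with x <ᵇ topValue P
... | true  = cong₂ (λ r s → (r , s) ∷ forgetCards Q) (sym (map-++ value P _)) (sym (map-++ time P _))
... | false = cong (_ ∷_) (place-forgetCards x i Q)

run-forgetCards : ∀ i σ Q → run i σ (forgetCards Q) ≡ forgetCards (deal i σ Q)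
run-forgetCards i []      Q = refl
run-forgetCards i (x ∷ σ) Q rewrite place-forgetCards x i Q = run-forgetCards (suc i) σ (insert (x , i) Q)

R-patience : ∀ σ → R σ ≡ insertionPiles (patience σ)
R-patience σ rewrite run-forgetCards 1 σ [] = sym (map-∘ (patience σ))

S-patience : ∀ σ → S σ ≡ recordingPiles (patience σ)
S-patience σ rewrite run-forgetCards 1 σ [] = sym (map-∘ (patience σ))

deal-++ : ∀ i xs ys Q → deal i (xs ++ ys) Q ≡ deal (i + length xs) ys (deal i xs Q)
deal-++ i []       ys Q rewrite +-identityʳ i = refl
deal-++ i (x ∷ xs) ys Q rewrite +-suc i (length xs) = deal-++ (suc i) xs ys (insert (x , i) Q)

patience-∷ʳ : ∀ σ x → patience (σ ∷ʳ x) ≡ insert (x , suc (length σ)) (patience σ)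
patience-∷ʳ σ x = deal-++ 1 σ [ x ] []

insert-All : ∀ {c} (Pr : Pile → Set) → (∀ {P} → Pr P → value c < topValue P → Pr (P ∷ʳ c)) →
  Pr [ c ] → ∀ {Q} → All Pr Q → All Pr (insert c Q)
insert-All Pr onto new {[]}    []       = new ∷ []
insert-All {c} Pr onto new {P ∷ Q} (p ∷ ps) with value c <ᵇ topValue P | <ᵇ-reflects-< (value c) (topValue P)
... | true  | ofʸ c<P = onto p c<P ∷ ps
... | false | _       = p ∷ insert-All Pr onto new ps

insert-middle : ∀ c Q₁ A Q₂ → All (λ P → topValue P < value c) Q₁ → value c < topValue A →
  insert c (Q₁ ++ A ∷ Q₂) ≡ Q₁ ++ (A ∷ʳ c) ∷ Q₂
insert-middle c []       A Q₂ []           c<A with value c <ᵇ topValue A | <ᵇ-reflects-< (value c) (topValue A)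
... | true  | _       = refl
... | false | ofⁿ c≮A = ⊥-elim (c≮A c<A)
insert-middle c (P ∷ Q₁) A Q₂ (P<c ∷ P<cs) c<A with value c <ᵇ topValue P | <ᵇ-reflects-< (value c) (topValue P)
... | true  | ofʸ c<P = ⊥-elim (<-asym c<P P<c)
... | false | _       = cong (P ∷_) (insert-middle c Q₁ A Q₂ P<cs c<A)

insert-end : ∀ c Q → All (λ P → topValue P < value c) Q → insert c Q ≡ Q ∷ʳ [ c ]
insert-end c []      []           = refl
insert-end c (P ∷ Q) (P<c ∷ P<cs) with value c <ᵇ topValue P | <ᵇ-reflects-< (value c) (topValue P)
... | true  | ofʸ c<P = ⊥-elim (<-asym c<P P<c)
... | false | _       = cong (P ∷_) (insert-end c Q P<cs)

insert-nonempty : ∀ c {Q} → All (_≢ []) Q → All (_≢ []) (insert c Q)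
insert-nonempty c = insert-All (_≢ []) (λ {P} _ _ → ∷ʳ-≢-[] P c) (λ ())

deal-nonempty : ∀ i σ Q → All (_≢ []) Q → All (_≢ []) (deal i σ Q)
deal-nonempty i []      Q ne = ne
deal-nonempty i (x ∷ σ) Q ne = deal-nonempty (suc i) σ (insert (x , i) Q) (insert-nonempty (x , i) ne)

concat-insert : ∀ c Q → concat (insert c Q) ↭ c ∷ concat Q
concat-insert c []      = ↭-refl
concat-insert c (P ∷ Q) with value c <ᵇ topValue P
... | true  rewrite ++-assoc P [ c ] (concat Q) = shift c P (concat Q)
... | false = ↭-trans (++⁺ˡ P (concat-insert c Q)) (shift c P (concat Q))

patience-values : ∀ σ → map value (concat (patience σ)) ↭ σ
patience-values σ = go (reverseView σ)
  where
  open PermutationReasoning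
  go : ∀ {σ} → Reverse σ → map value (concat (patience σ)) ↭ σ
  go []             = ↭-refl
  go (σ ∶ r ∶ʳ x) = begin
    map value (concat (patience (σ ∷ʳ x)))        ≡⟨ cong (map value ∘ concat) (patience-∷ʳ σ x) ⟩
    map value (concat (insert (x , _) (patience σ))) ↭⟨ ↭-map⁺ value (concat-insert _ (patience σ)) ⟩
    x ∷ map value (concat (patience σ))             <⟨ go r ⟩
    x ∷ σ                                           ↭⟨ ++-comm [ x ] σ ⟩
    σ ∷ʳ x                                          ∎

patience-times : ∀ σ → map time (concat (patience σ)) ↭ [1… length σ ]
patience-times σ = go (reverseView σ)
  where
  open PermutationReasoning
  go : ∀ {σ} → Reverse σ → map time (concat (patience σ)) ↭ [1… length σ ]
  go []             = ↭-refl
  go (σ ∶ r ∶ʳ x) = begin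
    map time (concat (patience (σ ∷ʳ x)))          ≡⟨ cong (map time ∘ concat) (patience-∷ʳ σ x) ⟩
    map time (concat (insert (x , n) (patience σ))) ↭⟨ ↭-map⁺ time (concat-insert _ (patience σ)) ⟩
    n ∷ map time (concat (patience σ))              <⟨ go r ⟩
    n ∷ [1… length σ ]                              ↭⟨ ++-comm [ n ] [1… length σ ] ⟩
    [1… length σ ] ∷ʳ n                             ≡⟨ sym ([1…]-∷ʳ (length σ)) ⟩
    [1… suc (length σ) ]                            ≡⟨ cong [1…_] (length-++-comm [ x ] σ) ⟩
    [1… length (σ ∷ʳ x) ]                           ∎
    where n = suc (length σ)

patience-earlier : ∀ σ → All (λ a → time a < suc (length σ)) (concat (patience σ))
patience-earlier σ = All.tabulate λ a∈ → s≤s (∈-[1…]⇒≤ (∈-resp-↭ (patience-times σ) (∈-map⁺ time a∈)))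

-- The invariant of the piles

Beneath : Card → Card → Set
Beneath a b = value b < value a × time a < time b

IsPile : Pile → Set
IsPile P = P ≢ [] × AllPairs Beneath P

-- 0 on the empty pile, which never occurs in valid piles
firstTime : Pile → ℕ
firstTime []      = 0
firstTime (c ∷ _) = time c

-- A card e of P′ dealt while c was the top of P passed over P, hence exceeds c.
Interlaced : Pile → Pile → Set
Interlaced P P′ = ∀ {c d e} → Adjacent c d P → e ∈ P′ → time c < time e → time e < time d → value c < value e

LeftOf : Pile → Pile → Set
LeftOf P P′ = topValue P < topValue P′ × firstTime P < firstTime P′ × Interlaced P P′

Valid : Piles → Set
Valid Q = All IsPile Q × AllPairs LeftOf Q

topValue-≤ : ∀ {P c} → IsPile P → c ∈ P → topValue P ≤ value c
topValue-≤ (P≢[] , beneath) c∈ =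
  top-≤ (map-≢-[] P≢[]) (AllPairs.map⁺ (AllPairs.map proj₁ beneath)) (∈-map⁺ value c∈)

topValue-∈ : ∀ {P} → P ≢ [] → ∃[ a ] a ∈ P × value a ≡ topValue P
topValue-∈ {P} P≢[] with initLast P
... | []      = ⊥-elim (P≢[] refl)
... | A ∷ʳ′ a = a , ∈-++⁺ʳ A (here refl) , sym (topValue-∷ʳ A a)

topCard : ∀ {P} c → P ≢ [] → ∃[ a ] a ∈ P × value a ≡ topValue P × Adjacent a c (P ∷ʳ c)
topCard {P} c P≢[] with initLast P
... | []      = ⊥-elim (P≢[] refl)
... | A ∷ʳ′ a = a , ∈-++⁺ʳ A (here refl) , sym (topValue-∷ʳ A a) , adjacent-∷ʳ∷ʳ A

firstTime-≤ : ∀ {P c} → IsPile P → c ∈ P → firstTime P ≤ time c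
firstTime-≤ (_ , _ ∷ _)        (here refl) = ≤-refl
firstTime-≤ (_ , beneath ∷ _)  (there c∈)  = <⇒≤ (proj₂ (All.lookup beneath c∈))

firstTime-∷ʳ : ∀ {P} c → P ≢ [] → firstTime (P ∷ʳ c) ≡ firstTime P
firstTime-∷ʳ {[]}    c P≢[] = ⊥-elim (P≢[] refl)
firstTime-∷ʳ {_ ∷ _} c _    = refl

firstTime-All : ∀ {Pr : ℕ → Set} {P} → P ≢ [] → All (Pr ∘ time) P → Pr (firstTime P)
firstTime-All P≢[] []       = ⊥-elim (P≢[] refl)
firstTime-All _    (pa ∷ _) = pa

straddle : ∀ {t e} A → firstTime A < t → e ∈ A → t < time e → t ∉ map time A →
  ∃[ c ] ∃[ d ] Adjacent c d A × time c < t × t < time d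
straddle (c ∷ A)         first<t (here refl) t<e _  = ⊥-elim (<-asym first<t t<e)
straddle {t} (c ∷ d ∷ A) first<t (there e∈) t<e t∉ with <-cmp (time d) t
... | tri> _ _ t<d  = c , d , here , first<t , t<d
... | tri≈ _ d≡t _  = ⊥-elim (t∉ (there (here (sym d≡t))))
... | tri< d<t _ _ with straddle (d ∷ A) d<t e∈ t<e (t∉ ∘ there)
...   | c′ , d′ , adj , c′<t , t<d′ = c′ , d′ , there adj , c′<t , t<d′

pile-∷ʳ : ∀ {P c} → IsPile P → value c < topValue P → All (λ a → time a < time c) P → IsPile (P ∷ʳ c)
pile-∷ʳ {P} {c} okP c<P earlier = ∷ʳ-≢-[] P c ,
  allPairs-∷ʳ⁺ (proj₂ okP) (All.tabulate λ a∈ → <-≤-trans c<P (topValue-≤ okP a∈) , All.lookup earlier a∈)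

interlaced-∷ʳˡ : ∀ {P P′ c} → IsPile P′ → topValue P < topValue P′ → Interlaced P P′ → Interlaced (P ∷ʳ c) P′
interlaced-∷ʳˡ {P} okP′ P<P′ il adj e∈ with adjacent-∷ʳ⁻ P adj
... | inj₁ adj′              = il adj′ e∈
... | inj₂ (A , refl , refl) = λ _ _ →
  subst (_< _) (topValue-∷ʳ A _) (<-≤-trans P<P′ (topValue-≤ okP′ e∈))

interlaced-∷ʳʳ : ∀ {P P′ c} → All (λ a → time a < time c) P → Interlaced P P′ → Interlaced P (P′ ∷ʳ c)
interlaced-∷ʳʳ {P′ = P′} earlier il adj e∈ with ∈-++⁻ P′ e∈
... | inj₁ e∈P′        = il adj e∈P′
... | inj₂ (here refl) = λ _ c<d → ⊥-elim (<-asym c<d (All.lookup earlier (proj₂ (adjacent-∈ adj))))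

leftOf-∷ʳˡ : ∀ {P P′ c} → IsPile P → value c < topValue P → IsPile P′ → LeftOf P P′ → LeftOf (P ∷ʳ c) P′
leftOf-∷ʳˡ {P} {c = c} okP c<P okP′ (P<P′ , first< , il) =
  subst (_< _) (sym (topValue-∷ʳ P c)) (<-trans c<P P<P′) ,
  subst (_< _) (sym (firstTime-∷ʳ c (proj₁ okP))) first< ,
  interlaced-∷ʳˡ okP′ P<P′ il

leftOf-∷ʳʳ : ∀ {P P′ c} → P ≢ [] → topValue P < value c → All (λ a → time a < time c) P →
  LeftOf P P′ → LeftOf P (P′ ∷ʳ c)
leftOf-∷ʳʳ {P} {P′} {c} P≢[] P<c earlier (_ , first< , il) =
  subst (_ <_) (sym (topValue-∷ʳ P′ c)) P<c , first<∷ʳ P′ first< , interlaced-∷ʳʳ earlier il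
  where
  first<∷ʳ : ∀ P′ → firstTime P < firstTime P′ → firstTime P < firstTime (P′ ∷ʳ c)
  first<∷ʳ []      _      = firstTime-All P≢[] earlier
  first<∷ʳ (_ ∷ _) first< = first<

leftOf-[_] : ∀ {P} c → P ≢ [] → topValue P < value c → All (λ a → time a < time c) P → LeftOf P [ c ]
leftOf-[ c ] P≢[] P<c earlier = P<c , firstTime-All P≢[] earlier , interlaced-∷ʳʳ {P′ = []} earlier (λ _ ())

insert-valid : ∀ {c} Q → Valid Q → All (λ a → value a ≢ value c × time a < time c) (concat Q) →
  Valid (insert c Q)
insert-valid []      _ _ = ((λ ()) , [] ∷ []) ∷ [] , [] ∷ []
insert-valid {c} (P ∷ Q) (okP ∷ oks , leftP ∷ lefts) fresh
  with value c <ᵇ topValue P | <ᵇ-reflects-< (value c) (topValue P)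
... | true  | ofʸ c<P =
  pile-∷ʳ okP c<P (All.map proj₂ (All.++⁻ˡ P fresh)) ∷ oks ,
  All.zipWith (λ (ok , l) → leftOf-∷ʳˡ okP c<P ok l) (oks , leftP) ∷ lefts
... | false | ofⁿ c≮P =
  okP ∷ proj₁ rest ,
  insert-All (LeftOf P) (λ l _ → leftOf-∷ʳʳ P≢[] P<c earlierP l) (leftOf-[ c ] P≢[] P<c earlierP) leftP ∷ proj₂ rest
  where
  P≢[]     = proj₁ okP
  earlierP = All.map proj₂ (All.++⁻ˡ P fresh)
  rest     = insert-valid Q (oks , lefts) (All.++⁻ʳ P fresh)
  P<c : topValue P < value c
  P<c with topValue-∈ P≢[]
  ... | a , a∈ , a≡P = ≤∧≢⇒< (≮⇒≥ c≮P) λ P≡c → proj₁ (All.lookup (All.++⁻ˡ P fresh) a∈) (trans a≡P P≡c)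

unique-∷ʳ⁻ : ∀ (σ : List ℕ) {x} → Unique (σ ∷ʳ x) → Unique σ × All (_≢ x) σ
unique-∷ʳ⁻ σ u = proj₁ (allPairs-++⁻ σ u) , allPairs-∷ʳ⁻ σ u

patience-valid : ∀ {σ : List ℕ} → Unique σ → Valid (patience σ)
patience-valid {σ} = go (reverseView σ)
  where
  go : ∀ {σ : List ℕ} → Reverse σ → Unique σ → Valid (patience σ)
  go []             _ = [] , []
  go (σ ∶ r ∶ʳ x) u =
    subst Valid (sym (patience-∷ʳ σ x)) (insert-valid (patience σ) (go r uσ) (All.zip
      (All.tabulate (λ a∈ → All.lookup x∉σ (∈-resp-↭ (patience-values σ) (∈-map⁺ value a∈))) ,
       patience-earlier σ)))
    where
    uσ  = proj₁ (unique-∷ʳ⁻ σ u)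
    x∉σ = proj₂ (unique-∷ʳ⁻ σ u)

-- Pattern avoidance

Matches : Pattern → Pattern → Card → Card → Card → Set
Matches p q x y z = p (value x) (value y) (value z) × q (time x) (time y) (time z)

Avoiding : (Card → Card → Card → Set) → List Card → Set
Avoiding T w = ∀ {x y z} → Occurs x y z w → ¬ T x y z

-- The default (0 , 0) mirrors the default 0 of at, so at (map value w) k ≡ value (cardAt w k) for every k.
cardAt : List Card → ℕ → Card
cardAt []       k       = 0 , 0
cardAt (c ∷ w)  zero    = c
cardAt (c ∷ w)  (suc k) = cardAt w k

at-map-value : ∀ w k → at (map value w) k ≡ value (cardAt w k)
at-map-value []      k       = refl
at-map-value (c ∷ w) zero    = refl
at-map-value (c ∷ w) (suc k) = at-map-value w k

at-map-time : ∀ w k → at (map time w) k ≡ time (cardAt w k)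
at-map-time []      k       = refl
at-map-time (c ∷ w) zero    = refl
at-map-time (c ∷ w) (suc k) = at-map-time w k

cardAt-∈ : ∀ {w k} → k < length w → cardAt w k ∈ w
cardAt-∈ {c ∷ w} {zero}  _         = here refl
cardAt-∈ {c ∷ w} {suc k} (s≤s k<) = there (cardAt-∈ k<)

∈⇒cardAt : ∀ {c w} → c ∈ w → ∃[ k ] k < length w × cardAt w k ≡ c
∈⇒cardAt (here refl) = zero , s≤s z≤n , refl
∈⇒cardAt (there c∈) with ∈⇒cardAt c∈
... | k , k< , eq = suc k , s≤s k< , eq

positions⇒occurs : ∀ w a c → suc a < c → c < length w → Occurs (cardAt w a) (cardAt w (suc a)) (cardAt w c) w
positions⇒occurs (x ∷ y ∷ w) zero    (suc (suc c)) _          (s≤s (s≤s c<)) = here (cardAt-∈ c<)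
positions⇒occurs (x ∷ y ∷ w) zero    (suc zero)    (s≤s ())   _
positions⇒occurs (x ∷ w)     (suc a) (suc c)       (s≤s a<c) (s≤s c<)        = there (positions⇒occurs w a c a<c c<)

occurs⇒positions : ∀ {x y z w} → Occurs x y z w →
  ∃[ a ] ∃[ c ] suc a < c × c < length w × cardAt w a ≡ x × cardAt w (suc a) ≡ y × cardAt w c ≡ z
occurs⇒positions (here z∈) with ∈⇒cardAt z∈
... | k , k< , eq = zero , suc (suc k) , s≤s (s≤s z≤n) , s≤s (s≤s k<) , refl , refl , eq
occurs⇒positions (there o) with occurs⇒positions o
... | a , c , a<c , c< , ex , ey , ez = suc a , suc c , s≤s a<c , s≤s c< , ex , ey , ez

matches-at : ∀ p q w a b c →
  (p (at (map value w) a) (at (map value w) b) (at (map value w) c)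
   × q (at (map time w) a) (at (map time w) b) (at (map time w) c))
  ≡ Matches p q (cardAt w a) (cardAt w b) (cardAt w c)
matches-at p q w a b c
  rewrite at-map-value w a | at-map-value w b | at-map-value w c
        | at-map-time w a  | at-map-time w b  | at-map-time w c = refl

avoiding⇒avoids : ∀ p q w → Avoiding (Matches p q) w → Avoids p q (map value w) (map time w)
avoiding⇒avoids p q w av (a , c , a<c , c< , _ , m) =
  av (positions⇒occurs w a c a<c (subst (c <_) (length-map value w) c<))
     (subst id (matches-at p q w a (suc a) c) m)

avoids⇒avoiding : ∀ p q w → Avoids p q (map value w) (map time w) → Avoiding (Matches p q) w
avoids⇒avoiding p q w av o m with occurs⇒positions o
... | a , c , a<c , c< , refl , refl , refl =
  av (a , c , a<c , subst (c <_) (sym (length-map value w)) c< , subst (c <_) (sym (length-map time w)) c< ,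
      subst id (sym (matches-at p q w a (suc a) c)) m)

interlaced-concat : ∀ {P Q c d e} → All (LeftOf P) Q → Adjacent c d P → e ∈ concat Q →
  time c < time e → time e < time d → value c < value e
interlaced-concat {Q = Q} lefts adj e∈ with ∈-concat⁻′ Q e∈
... | P′ , e∈P′ , P′∈ = proj₂ (proj₂ (All.lookup lefts P′∈)) adj e∈P′

topValue-<-concat : ∀ {P Q e} → All (LeftOf P) Q → All IsPile Q → e ∈ concat Q → topValue P < value e
topValue-<-concat {Q = Q} lefts oks e∈ with ∈-concat⁻′ Q e∈
... | P′ , e∈P′ , P′∈ = <-≤-trans (proj₁ (All.lookup lefts P′∈)) (topValue-≤ (All.lookup oks P′∈) e∈P′)

-- An occurrence x y ⋯ z lies in one pile, or has x y adjacent in a pile and z in a later one,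
-- or has x on top of a pile and y at the bottom of a later one; the three hypotheses exclude these.
valid⇒avoiding : ∀ (T : Card → Card → Card → Set) →
  (∀ {x y z} → T x y z → value y < value x) →
  (∀ {x y z} → Beneath x y → Beneath y z → ¬ T x y z) →
  (∀ {x y z} → Beneath x y → (time x < time z → time z < time y → value x < value z) → ¬ T x y z) →
  ∀ Q → Valid Q → Avoiding T (concat Q)
valid⇒avoiding T descent inPile across (P ∷ Q) (okP ∷ oks , leftP ∷ lefts) o with occurs-++⁻ P o
... | inj₁ oP                              = uncurry inPile (occurs-allPairs oP (proj₂ okP))
... | inj₂ (inj₁ (adj , z∈))               =
  across (adjacent-allPairs adj (proj₂ okP)) (interlaced-concat leftP adj z∈)
... | inj₂ (inj₂ (inj₁ ((ws , refl) , y∈))) = λ t →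
  <-asym (descent t) (subst (_< _) (topValue-∷ʳ ws _) (topValue-<-concat leftP oks y∈))
... | inj₂ (inj₂ (inj₂ oQ))                = valid⇒avoiding T descent inPile across Q (oks , lefts) oQ

valid⇒avoiding-31-2-13-2 : ∀ Q → Valid Q → Avoiding (Matches p31-2 p13-2) (concat Q)
valid⇒avoiding-31-2-13-2 = valid⇒avoiding _
  (λ ((y<z , z<x) , _) → <-trans y<z z<x)
  (λ _ (_ , ty<tz) (_ , _ , tz<ty) → <-asym ty<tz tz<ty)
  (λ _ interlaced ((_ , z<x) , times) → <-asym z<x (uncurry interlaced times))

valid⇒avoiding-31-2-32-1 : ∀ Q → Valid Q → Avoiding (Matches p31-2 p32-1) (concat Q)
valid⇒avoiding-31-2-32-1 = valid⇒avoiding _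
  (λ ((y<z , z<x) , _) → <-trans y<z z<x)
  (λ (_ , tx<ty) _ (_ , _ , ty<tx) → <-asym tx<ty ty<tx)
  (λ (_ , tx<ty) _ (_ , _ , ty<tx) → <-asym tx<ty ty<tx)

valid⇒avoiding-32-1-13-2 : ∀ Q → Valid Q → Avoiding (Matches p32-1 p13-2) (concat Q)
valid⇒avoiding-32-1-13-2 = valid⇒avoiding _
  (λ ((_ , y<x) , _) → y<x)
  (λ _ (_ , ty<tz) (_ , _ , tz<ty) → <-asym ty<tz tz<ty)
  (λ _ interlaced ((z<y , y<x) , times) → <-asym (<-trans z<y y<x) (uncurry interlaced times))

avoiding⇒above : ∀ {w c d e} → Avoiding (Matches p31-2 p13-2) w → Avoiding (Matches p32-1 p13-2) w →
  AllPairs (λ a b → value a ≢ value b) w → Occurs c d e w →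
  value d < value c → time c < time e → time e < time d → value c < value e
avoiding⇒above {c = c} {d} {e} av₁ av₃ distinct o d<c times₁ times₂ with <-cmp (value c) (value e)
... | tri< c<e _ _ = c<e
... | tri≈ _ c≡e _ = ⊥-elim (proj₁ (occurs-allPairs-last o distinct) c≡e)
... | tri> _ _ e<c with <-cmp (value d) (value e)
...   | tri< d<e _ _ = ⊥-elim (av₁ o ((d<e , e<c) , (times₁ , times₂)))
...   | tri≈ _ d≡e _ = ⊥-elim (proj₂ (occurs-allPairs-last o distinct) d≡e)
...   | tri> _ _ e<d = ⊥-elim (av₃ o ((e<d , d<c) , (times₁ , times₂)))

avoiding⇒interlaced : ∀ Q → All IsPile Q → AllPairs (λ a b → value a ≢ value b) (concat Q) →
  Avoiding (Matches p31-2 p13-2) (concat Q) → Avoiding (Matches p32-1 p13-2) (concat Q) → AllPairs Interlaced Q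
avoiding⇒interlaced []      _              _        _   _   = []
avoiding⇒interlaced (P ∷ Q) ((_ , beneath) ∷ oks) distinct av₁ av₃ =
  All.tabulate (λ P′∈ adj e∈ → avoiding⇒above av₁ av₃ distinct (adjacent⇒occurs adj (∈-concat⁺′ e∈ P′∈))
                                 (proj₁ (adjacent-allPairs adj beneath))) ∷
  avoiding⇒interlaced Q oks (proj₁ (proj₂ (allPairs-++⁻ P distinct))) (av₁ ∘ occurs-++⁺ʳ P) (av₃ ∘ occurs-++⁺ʳ P)

-- Pile configurations

Decreasing : List ℕ → Set
Decreasing r = r ≢ [] × AllPairs _>_ r

LegalPiles : PileConf → Set
LegalPiles P = All Decreasing P × AllPairs (λ r r′ → top r < top r′) P

deal-onto-last : ∀ l i Q₀ A → AllPairs _>_ l → All (_< topValue A) l →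
  All (λ v → All (λ B → topValue B < v) Q₀) l →
  ∃[ A′ ] deal i l (Q₀ ∷ʳ A) ≡ Q₀ ∷ʳ A′ × map value A′ ≡ map value A ++ l
deal-onto-last []      i Q₀ A _ _ _ = A , refl , sym (++-identityʳ _)
deal-onto-last (v ∷ l) i Q₀ A (v>l ∷ dec) (v<A ∷ _) (Q₀<v ∷ Q₀<l)
  rewrite insert-middle (v , i) Q₀ A [] Q₀<v v<A
  with deal-onto-last l (suc i) Q₀ (A ∷ʳ (v , i)) dec (subst (λ t → All (_< t) l) (sym (topValue-∷ʳ A _)) v>l) Q₀<l
... | A′ , dealt , values = A′ , dealt , (begin
  map value A′                      ≡⟨ values ⟩
  map value (A ∷ʳ (v , i)) ++ l     ≡⟨ cong (_++ l) (map-++ value A _) ⟩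
  (map value A ∷ʳ v) ++ l           ≡⟨ ++-assoc (map value A) [ v ] l ⟩
  map value A ++ v ∷ l              ∎)
  where open ≡-Reasoning

below-top-below : ∀ {r v Q} → r ≢ [] → AllPairs _>_ r → All (λ B → topValue B < top r) Q → v ∈ r →
  All (λ B → topValue B < v) Q
below-top-below r≢[] dec Q<r v∈ = All.map (λ B<r → <-≤-trans B<r (top-≤ r≢[] dec v∈)) Q<r

deal-legal : ∀ P i Q₀ → LegalPiles P → All (λ r → All (λ B → topValue B < top r) Q₀) P →
  insertionPiles (deal i (concat P) Q₀) ≡ insertionPiles Q₀ ++ P
deal-legal []             i Q₀ _ _ = sym (++-identityʳ _)
deal-legal ([] ∷ P)       i Q₀ ((r≢[] , _) ∷ _ , _) _ = ⊥-elim (r≢[] refl)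
deal-legal ((b ∷ l) ∷ P) i Q₀ ((r≢[] , dec) ∷ decs , r<P ∷ tops) (Q₀<r ∷ Q₀<P)
  rewrite deal-++ i (b ∷ l) (concat P) Q₀ | insert-end (b , i) Q₀ (below-top-below r≢[] dec Q₀<r (here refl))
  with deal-onto-last l (suc i) Q₀ [ (b , i) ] (AllPairs.tail dec) (AllPairs.head dec)
         (All.tabulate (below-top-below r≢[] dec Q₀<r ∘ there))
... | A′ , dealt , values rewrite dealt = begin
  insertionPiles (deal _ (concat P) (Q₀ ∷ʳ A′)) ≡⟨ deal-legal P _ (Q₀ ∷ʳ A′) (decs , tops) Q₀A′<P ⟩
  insertionPiles (Q₀ ∷ʳ A′) ++ P                ≡⟨ cong (_++ P) (map-++ (map value) Q₀ [ A′ ]) ⟩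
  (insertionPiles Q₀ ∷ʳ map value A′) ++ P     ≡⟨ ++-assoc (insertionPiles Q₀) _ P ⟩
  insertionPiles Q₀ ++ map value A′ ∷ P         ≡⟨ cong (λ r → insertionPiles Q₀ ++ r ∷ P) values ⟩
  insertionPiles Q₀ ++ (b ∷ l) ∷ P              ∎
  where
  open ≡-Reasoning
  Q₀A′<P : All (λ r → All (λ B → topValue B < top r) (Q₀ ∷ʳ A′)) P
  Q₀A′<P = All.zipWith (λ (Q₀<r′ , r<r′) → All.++⁺ Q₀<r′ (subst (_< _) (cong top (sym values)) r<r′ ∷ []))
    (Q₀<P , r<P)

R-concat : ∀ P → LegalPiles P → R (concat P) ≡ P
R-concat P legal = trans (R-patience (concat P)) (deal-legal P 1 [] legal (All.tabulate λ _ → []))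

legal-insertionPiles : ∀ {Q} → Valid Q → LegalPiles (insertionPiles Q)
legal-insertionPiles (oks , lefts) =
  All.map⁺ (All.map (λ (P≢[] , beneath) → map-≢-[] P≢[] , AllPairs.map⁺ (AllPairs.map proj₁ beneath)) oks) ,
  AllPairs.map⁺ (AllPairs.map proj₁ lefts)

top-recordingPile : ∀ {P} → P ≢ [] → top (reverse (map time P)) ≡ firstTime P
top-recordingPile {[]}    P≢[] = ⊥-elim (P≢[] refl)
top-recordingPile {a ∷ P} _ rewrite unfold-reverse (time a) (map time P) = top-∷ʳ (reverse (map time P)) (time a)

legal-recordingPiles : ∀ {Q} → Valid Q → LegalPiles (recordingPiles Q)
legal-recordingPiles (oks , lefts) =
  All.map⁺ (All.map (λ (P≢[] , beneath) →
    reverse-≢-[] (map-≢-[] P≢[]) , allPairs-reverse (AllPairs.map⁺ (AllPairs.map proj₂ beneath))) oks) ,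
  AllPairs.map⁺ (allPairs-zipWith-All
    (λ (P≢[] , _) (P′≢[] , _) (_ , first< , _) →
      subst₂ _<_ (sym (top-recordingPile P≢[])) (sym (top-recordingPile P′≢[])) first<) oks lefts)

legal⇒valid : ∀ Q → LegalPiles (insertionPiles Q) → LegalPiles (recordingPiles Q) →
  AllPairs (λ a b → value a ≢ value b) (concat Q) →
  Avoiding (Matches p31-2 p13-2) (concat Q) → Avoiding (Matches p32-1 p13-2) (concat Q) → Valid Q
legal⇒valid Q (decR , topsR) (decS , topsS) distinct av₁ av₃ = oks ,
  allPairs-zipWith-All
    (λ (P≢[] , _) (P′≢[] , _) (top< , first< , il) →
      top< , subst₂ _<_ (top-recordingPile P≢[]) (top-recordingPile P′≢[]) first< , il)
    oks (AllPairs.zip (AllPairs.map⁻ topsR , AllPairs.zip (AllPairs.map⁻ topsS , avoiding⇒interlaced Q oks distinct av₁ av₃)))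
  where
  pile : ∀ {P} → Decreasing (map value P) → Decreasing (reverse (map time P)) → IsPile P
  pile {P} (r≢[] , decr) (_ , decs) = r≢[] ∘ cong (map value) ,
    AllPairs.zip (AllPairs.map⁻ decr , AllPairs.map⁻ (subst (AllPairs _<_) (reverse-involutive (map time P)) (allPairs-reverse decs)))
  oks : All IsPile Q
  oks = All.zipWith (λ (dr , ds) → pile dr ds) (All.map⁻ decR , All.map⁻ decS)

RPW-insertionPiles : ∀ Q → RPW (insertionPiles Q) ≡ map value (concat Q)
RPW-insertionPiles Q = concat-map Q

RPW′-recordingPiles : ∀ Q → RPW′ (recordingPiles Q) ≡ map time (concat Q)
RPW′-recordingPiles Q = begin
  concat (map reverse (map (reverse ∘ map time) Q)) ≡⟨ cong concat (sym (map-∘ Q)) ⟩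
  concat (map (reverse ∘ reverse ∘ map time) Q)     ≡⟨ cong concat (map-cong (reverse-involutive ∘ map time) Q) ⟩
  concat (map (map time) Q)                         ≡⟨ concat-map Q ⟩
  map time (concat Q)                               ∎
  where open ≡-Reasoning

concat-recordingPiles : ∀ Q → concat (recordingPiles Q) ↭ map time (concat Q)
concat-recordingPiles []      = ↭-refl
concat-recordingPiles (P ∷ Q) = begin
  reverse (map time P) ++ concat (recordingPiles Q) ↭⟨ ↭-++⁺ (↭-reverse (map time P)) (concat-recordingPiles Q) ⟩
  map time P ++ map time (concat Q)                 ≡⟨ map-++ time P (concat Q) ⟨
  map time (P ++ concat Q)                          ∎
  where open PermutationReasoning

sh-insertionPiles : ∀ Q → sh (insertionPiles Q) ≡ map length Q
sh-insertionPiles Q = trans (sym (map-∘ Q)) (map-cong (length-map value) Q)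

sh-recordingPiles : ∀ Q → sh (recordingPiles Q) ≡ map length Q
sh-recordingPiles Q = trans (sym (map-∘ Q)) (map-cong (λ P → trans (length-reverse (map time P)) (length-map time P)) Q)

avoiding⇒pileWords-avoid : ∀ p q Q → Avoiding (Matches p q) (concat Q) →
  Avoids p q (RPW (insertionPiles Q)) (RPW′ (recordingPiles Q))
avoiding⇒pileWords-avoid p q Q av =
  subst₂ (Avoids p q) (sym (RPW-insertionPiles Q)) (sym (RPW′-recordingPiles Q)) (avoiding⇒avoids p q (concat Q) av)

pileWords-avoid⇒avoiding : ∀ p q Q → Avoids p q (RPW (insertionPiles Q)) (RPW′ (recordingPiles Q)) →
  Avoiding (Matches p q) (concat Q)
pileWords-avoid⇒avoiding p q Q av =
  avoids⇒avoiding p q (concat Q) (subst₂ (Avoids p q) (RPW-insertionPiles Q) (RPW′-recordingPiles Q) av)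

isPerm-length : ∀ {n σ} → IsPerm n σ → length σ ≡ n
isPerm-length {n} σ↭ = trans (↭-length σ↭) (length-[1…] n)

isPerm-unique : ∀ {n σ} → IsPerm n σ → Unique σ
isPerm-unique {n} σ↭ = unique-resp-↭ (↭-sym σ↭) (unique-[1…] n)

isPileConf⇒legal : ∀ {n P} → IsPileConf n P → LegalPiles P × concat P ↭ [1… n ]
isPileConf⇒legal {n} (τ , τ↭ , refl) =
  subst LegalPiles (sym (R-patience τ)) (legal-insertionPiles (patience-valid (isPerm-unique τ↭))) ,
  (begin
    concat (R τ)                         ≡⟨ cong concat (R-patience τ) ⟩
    concat (insertionPiles (patience τ)) ≡⟨ RPW-insertionPiles (patience τ) ⟩
    map value (concat (patience τ))      ↭⟨ patience-values τ ⟩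
    τ                                    ↭⟨ τ↭ ⟩
    [1… n ]                              ∎)
  where open PermutationReasoning

-- S σ is a legal pile configuration, so it is R of its own reading word.
S-isPileConf : ∀ {n σ} → IsPerm n σ → IsPileConf n (S σ)
S-isPileConf {n} {σ} σ↭ = concat (S σ) , concatS↭ , R-concat (S σ) legal
  where
  Q = patience σ
  legal : LegalPiles (S σ)
  legal = subst LegalPiles (sym (S-patience σ)) (legal-recordingPiles (patience-valid (isPerm-unique σ↭)))
  open PermutationReasoning
  concatS↭ : concat (S σ) ↭ [1… n ]
  concatS↭ = begin
    concat (S σ)                 ≡⟨ cong concat (S-patience σ) ⟩
    concat (recordingPiles Q)    ↭⟨ concat-recordingPiles Q ⟩
    map time (concat Q)          ↭⟨ patience-times σ ⟩
    [1… length σ ]               ≡⟨ cong [1…_] (isPerm-length σ↭) ⟩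
    [1… n ]                      ∎

patience-inΣ : ∀ n σ → IsPerm n σ → InΣ n (R σ) (S σ)
patience-inΣ n σ σ↭ =
  (σ , σ↭ , refl) , S-isPileConf σ↭ ,
  subst₂ (λ R S → sh R ≡ sh S) (sym (R-patience σ)) (sym (S-patience σ))
    (trans (sh-insertionPiles Q) (sym (sh-recordingPiles Q))) ,
  avoids (valid⇒avoiding-31-2-13-2 Q valid) ,
  avoids (valid⇒avoiding-31-2-32-1 Q valid) ,
  avoids (valid⇒avoiding-32-1-13-2 Q valid)
  where
  Q     = patience σ
  valid = patience-valid (isPerm-unique σ↭)
  avoids : ∀ {p q} → Avoiding (Matches p q) (concat Q) → Avoids p q (RPW (R σ)) (RPW′ (S σ))
  avoids {p} {q} av = subst₂ (λ R S → Avoids p q (RPW R) (RPW′ S)) (sym (R-patience σ)) (sym (S-patience σ))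
    (avoiding⇒pileWords-avoid p q Q av)

-- Injectivity

insert-injective : ∀ {x y m} Q Q′ → All (_≢ []) Q → All (_≢ []) Q′ →
  All (λ a → time a < m) (concat Q) → All (λ a → time a < m) (concat Q′) →
  insert (x , m) Q ≡ insert (y , m) Q′ → x ≡ y × Q ≡ Q′
insert-injective []      []       _ _ _ _ refl = refl , refl
insert-injective {y = y} [] (P′ ∷ Q′) _ (P′≢[] ∷ _) _ earlier′ eq
  with y <ᵇ topValue P′
... | true  = ⊥-elim (P′≢[] (sym (proj₁ (∷ʳ-injective [] P′ (proj₁ (∷-injective eq))))))
... | false with ∷-injective eq
...   | refl , _ = ⊥-elim (<-irrefl refl (All.head earlier′))
insert-injective {x = x} (P ∷ Q) [] (P≢[] ∷ _) _ earlier _ eq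
  with x <ᵇ topValue P
... | true  = ⊥-elim (P≢[] (proj₁ (∷ʳ-injective P [] (proj₁ (∷-injective eq)))))
... | false with ∷-injective eq
...   | refl , _ = ⊥-elim (<-irrefl refl (All.head earlier))
insert-injective {x} {y} (P ∷ Q) (P′ ∷ Q′) ne ne′ earlier earlier′ eq
  with x <ᵇ topValue P | y <ᵇ topValue P′
... | true  | true  with ∷-injective eq
...   | P∷ʳ≡ , refl with ∷ʳ-injective P P′ P∷ʳ≡
...     | refl , refl = refl , refl
insert-injective (P ∷ Q) (P′ ∷ Q′) ne ne′ earlier earlier′ eq
    | true  | false with ∷-injective eq
...   | refl , _ = ⊥-elim (<-irrefl refl (All.lookup earlier′ (∈-++⁺ˡ (∈-++⁺ʳ P (here refl)))))
insert-injective (P ∷ Q) (P′ ∷ Q′) ne ne′ earlier earlier′ eq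
    | false | true  with ∷-injective eq
...   | refl , _ = ⊥-elim (<-irrefl refl (All.lookup earlier (∈-++⁺ˡ (∈-++⁺ʳ P′ (here refl)))))
insert-injective (P ∷ Q) (P′ ∷ Q′) ne ne′ earlier earlier′ eq
    | false | false with ∷-injective eq
...   | refl , eq′ with insert-injective Q Q′ (All.tail ne) (All.tail ne′) (All.++⁻ʳ P earlier) (All.++⁻ʳ P earlier′) eq′
...     | refl , refl = refl , refl

patience-injective : ∀ {σ τ} → length σ ≡ length τ → patience σ ≡ patience τ → σ ≡ τ
patience-injective {σ} {τ} = go (reverseView σ) (reverseView τ)
  where
  go : ∀ {σ τ} → Reverse σ → Reverse τ → length σ ≡ length τ → patience σ ≡ patience τ → σ ≡ τ
  go []             []             _   _  = refl
  go []             (τ ∶ _ ∶ʳ y)   len _  = ⊥-elim (0≢1+n (trans len (sym (length-++-comm [ y ] τ))))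
  go (σ ∶ _ ∶ʳ x)   []             len _  = ⊥-elim (0≢1+n (trans (sym len) (sym (length-++-comm [ x ] σ))))
  go (σ ∶ rσ ∶ʳ x) (τ ∶ rτ ∶ʳ y) len eq = cong₂ _∷ʳ_ (go rσ rτ lenστ (proj₂ inserts≡)) (proj₁ inserts≡)
    where
    lenστ : length σ ≡ length τ
    lenστ = suc-injective (trans (length-++-comm [ x ] σ) (trans len (length-++-comm τ [ y ])))
    open ≡-Reasoning
    inserts≡ : x ≡ y × patience σ ≡ patience τ
    inserts≡ = insert-injective (patience σ) (patience τ) (deal-nonempty 1 σ [] []) (deal-nonempty 1 τ [] [])
      (patience-earlier σ) (subst (λ k → All (λ a → time a < suc k) _) (sym lenστ) (patience-earlier τ)) (begin
        insert (x , suc (length σ)) (patience σ) ≡⟨ patience-∷ʳ σ x ⟨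
        patience (σ ∷ʳ x)                        ≡⟨ eq ⟩
        patience (τ ∷ʳ y)                        ≡⟨ patience-∷ʳ τ y ⟩
        insert (y , suc (length τ)) (patience τ) ≡⟨ cong (λ k → insert (y , suc k) (patience τ)) lenστ ⟨
        insert (y , suc (length σ)) (patience τ) ∎)

cards : PileConf → PileConf → Piles
cards Rc Sc = zipWith zip Rc (map reverse Sc)

zip-values-times : ∀ (P : Pile) → zip (map value P) (map time P) ≡ P
zip-values-times []      = refl
zip-values-times (c ∷ P) = cong (c ∷_) (zip-values-times P)

values-zip : ∀ (r s : List ℕ) → length r ≡ length s → map value (zip r s) ≡ r
values-zip []      []      _   = refl
values-zip (v ∷ r) (t ∷ s) len = cong (v ∷_) (values-zip r s (suc-injective len))

times-zip : ∀ (r s : List ℕ) → length r ≡ length s → map time (zip r s) ≡ s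
times-zip []      []      _   = refl
times-zip (v ∷ r) (t ∷ s) len = cong (t ∷_) (times-zip r s (suc-injective len))

cards-recover : ∀ Q → cards (insertionPiles Q) (recordingPiles Q) ≡ Q
cards-recover []      = refl
cards-recover (P ∷ Q) =
  cong₂ _∷_ (trans (cong (zip (map value P)) (reverse-involutive (map time P))) (zip-values-times P)) (cards-recover Q)

insertionPiles-cards : ∀ Rc Sc → sh Rc ≡ sh Sc → insertionPiles (cards Rc Sc) ≡ Rc
insertionPiles-cards []       []       _  = refl
insertionPiles-cards (r ∷ Rc) (s ∷ Sc) sh≡ with ∷-injective sh≡
... | len , sh≡′ = cong₂ _∷_ (values-zip r (reverse s) (trans len (sym (length-reverse s))))
                             (insertionPiles-cards Rc Sc sh≡′)

recordingPiles-cards : ∀ Rc Sc → sh Rc ≡ sh Sc → recordingPiles (cards Rc Sc) ≡ Sc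
recordingPiles-cards []       []       _  = refl
recordingPiles-cards (r ∷ Rc) (s ∷ Sc) sh≡ with ∷-injective sh≡
... | len , sh≡′ = cong₂ _∷_
  (trans (cong reverse (times-zip r (reverse s) (trans len (sym (length-reverse s))))) (reverse-involutive s))
  (recordingPiles-cards Rc Sc sh≡′)

cards-RS : ∀ σ → cards (R σ) (S σ) ≡ patience σ
cards-RS σ rewrite R-patience σ | S-patience σ = cards-recover (patience σ)

RS-injective : ∀ n σ τ → IsPerm n σ → IsPerm n τ → (R σ , S σ) ≡ (R τ , S τ) → σ ≡ τ
RS-injective n σ τ σ↭ τ↭ RS≡ = patience-injective (trans (isPerm-length σ↭) (sym (isPerm-length τ↭))) (begin
  patience σ        ≡⟨ cards-RS σ ⟨
  cards (R σ) (S σ) ≡⟨ cong (uncurry cards) RS≡ ⟩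
  cards (R τ) (S τ) ≡⟨ cards-RS τ ⟩
  patience τ        ∎)
  where open ≡-Reasoning

-- Surjectivity

times-bounded : ∀ {n} {w : List Card} → map time w ↭ [1… n ] → All (λ e → time e ≤ n) w
times-bounded w↭ = All.tabulate λ e∈ → ∈-[1…]⇒≤ (∈-resp-↭ w↭ (∈-map⁺ time e∈))

times-distinct : ∀ {n} {w : List Card} → map time w ↭ [1… n ] → AllPairs (λ a b → time a ≢ time b) w
times-distinct {n} w↭ = AllPairs.map⁻ (unique-resp-↭ (↭-sym w↭) (unique-[1…] n))

times-dropLast : ∀ {k c W W′} → map time W ↭ [1… suc k ] → W ↭ c ∷ W′ → time c ≡ suc k → map time W′ ↭ [1… k ]
times-dropLast {k} {c} {W} {W′} W↭ W↭c∷W′ refl = drop-∷ (begin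
  time c ∷ map time W′  ↭⟨ ↭-map⁺ time (↭-sym W↭c∷W′) ⟩
  map time W            ↭⟨ W↭ ⟩
  [1… suc k ]           ≡⟨ [1…]-∷ʳ k ⟩
  [1… k ] ∷ʳ suc k      ↭⟨ ++-comm [1… k ] [ suc k ] ⟩
  suc k ∷ [1… k ]       ∎)
  where open PermutationReasoning

pile-init : ∀ {A c} → IsPile (A ∷ʳ c) → A ≢ [] → IsPile A
pile-init {A} (_ , beneath) A≢[] = A≢[] , proj₁ (allPairs-++⁻ A beneath)

top-below-init : ∀ {A c} → IsPile (A ∷ʳ c) → A ≢ [] → value c < topValue A
top-below-init {A} (_ , beneath) A≢[] with topValue-∈ A≢[]
... | a , a∈ , a≡ = subst (_ <_) a≡ (proj₁ (All.lookup (allPairs-∷ʳ⁻ A beneath) a∈))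

leftOf-dropTopʳ : ∀ {B A c} → IsPile (A ∷ʳ c) → A ≢ [] → LeftOf B (A ∷ʳ c) → LeftOf B A
leftOf-dropTopʳ {B} {A} {c} okP A≢[] (B<P , first< , il) =
  <-trans (subst (_ <_) (topValue-∷ʳ A c) B<P) (top-below-init okP A≢[]) ,
  subst (_ <_) (firstTime-∷ʳ c A≢[]) first< ,
  λ adj e∈ → il adj (∈-++⁺ˡ e∈)

interlaced-topValue< : ∀ {A b a w} → IsPile A → Interlaced A b → w ∈ b → firstTime A < time w →
  a ∈ A → time w < time a → time w ∉ map time A → topValue A < value w
interlaced-topValue< okA il w∈ first<w a∈ w<a w∉A with straddle _ first<w a∈ w<a w∉A
... | c , _ , adj , c<w , w<d = ≤-<-trans (topValue-≤ okA (proj₁ (adjacent-∈ adj))) (il adj w∈ c<w w<d)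

-- If the top card a of A was dealt before the top card w of b, Interlaced for a and c gives a < w;
-- otherwise w was dealt between two adjacent cards of A.
topValue-init< : ∀ {A c b} → IsPile (A ∷ʳ c) → A ≢ [] → IsPile b → LeftOf (A ∷ʳ c) b →
  All (λ e → time e < time c) b → All (λ a → All (λ e → time a ≢ time e) b) A → topValue A < topValue b
topValue-init< {A} {c} okP A≢[] okb (_ , first< , il) later distinct
  with topCard c A≢[] | topValue-∈ (proj₁ okb)
... | a , a∈ , a≡ , adj | w , w∈ , w≡ with <-cmp (time a) (time w)
...   | tri< a<w _ _ = subst₂ _<_ a≡ w≡ (il adj w∈ a<w (All.lookup later w∈))
...   | tri≈ _ a≡w _ = ⊥-elim (All.lookup (All.lookup distinct a∈) w∈ a≡w)
...   | tri> _ _ w<a = subst (_ <_) w≡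
  (interlaced-topValue< (pile-init okP A≢[]) (il ∘ adjacent-++⁺ˡ [ c ]) w∈ first<w a∈ w<a w∉A)
  where
  first<w = <-≤-trans (subst (_< _) (firstTime-∷ʳ c A≢[]) first<) (firstTime-≤ okb w∈)
  w∉A = All.All¬⇒¬Any (All.map⁺ (All.map (λ d w≡ → All.lookup d w∈ (sym w≡)) distinct))

leftOf-dropTopˡ : ∀ {A c b} → IsPile (A ∷ʳ c) → A ≢ [] → IsPile b →
  All (λ e → time e < time c) b → All (λ a → All (λ e → time a ≢ time e) b) A → LeftOf (A ∷ʳ c) b → LeftOf A b
leftOf-dropTopˡ {c = c} okP A≢[] okb later distinct left@(_ , first< , il) =
  topValue-init< okP A≢[] okb left later distinct ,
  subst (_< _) (firstTime-∷ʳ c A≢[]) first< ,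
  il ∘ adjacent-++⁺ˡ [ c ]

Predecessor : ℕ → Card → Piles → Set
Predecessor k c Q = ∃[ Q′ ] Valid Q′ × map time (concat Q′) ↭ [1… k ] × insert c Q′ ≡ Q

remove-singleton-pile : ∀ k Q₁ x Q₂ → let Q = Q₁ ++ [ (x , suc k) ] ∷ Q₂ in
  Valid Q → map time (concat Q) ↭ [1… suc k ] → Predecessor k (x , suc k) Q
remove-singleton-pile k Q₁ x [] (oks , lefts) Q↭ =
  Q₁ , (All.++⁻ˡ Q₁ oks , proj₁ (allPairs-++⁻ Q₁ lefts)) ,
  times-dropLast Q↭ (subst (λ W → concat (Q₁ ++ [ c ] ∷ []) ↭ c ∷ W)
    (trans (concat-middle Q₁ [] []) (++-identityʳ (concat Q₁))) (concat-middle-∷ʳ Q₁ [] c [])) refl ,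
  insert-end c Q₁ (All.map (proj₁ ∘ All.head) (proj₂ (proj₂ (allPairs-++⁻ Q₁ lefts))))
  where c = (x , suc k)
remove-singleton-pile k Q₁ x (b ∷ Q₂) (oks , lefts) Q↭ =
  ⊥-elim (<-irrefl refl (<-≤-trans first< (firstTime-All (proj₁ okb) (All.head (All.tail (All.++⁻ʳ Q₁ bounded))))))
  where
  okb     = All.head (All.tail (All.++⁻ʳ Q₁ oks))
  first<  = proj₁ (proj₂ (All.head (AllPairs.head (proj₁ (proj₂ (allPairs-++⁻ Q₁ lefts))))))
  bounded = All.concat⁻ (times-bounded Q↭)

remove-top-card : ∀ k Q₁ A x Q₂ → A ≢ [] → let Q = Q₁ ++ (A ∷ʳ (x , suc k)) ∷ Q₂ in
  Valid Q → map time (concat Q) ↭ [1… suc k ] → Predecessor k (x , suc k) Q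
remove-top-card k Q₁ A x Q₂ A≢[] (oks , lefts) Q↭ =
  Q₁ ++ A ∷ Q₂ ,
  (All.++⁺ (All.++⁻ˡ Q₁ oks) (pile-init okP A≢[] ∷ okQ₂) ,
   allPairs-replace Q₁ lefts (All.tabulate λ _ → leftOf-dropTopʳ okP A≢[])
     (All.tabulate λ b∈ → leftOf-dropTopˡ okP A≢[] (All.lookup okQ₂ b∈) (later b∈) (All.tabulate λ a∈ →
       All.tabulate λ e∈ → All.lookup (All.lookup crossP (∈-++⁺ˡ a∈)) (∈-concat⁺′ e∈ b∈)))) ,
  times-dropLast Q↭ (concat-middle-∷ʳ Q₁ A c Q₂) refl ,
  insert-middle c Q₁ A Q₂ Q₁<c (top-below-init okP A≢[])
  where
  c   = (x , suc k)
  P   = A ∷ʳ c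
  okP = All.head (All.++⁻ʳ Q₁ oks)
  okQ₂ = All.tail (All.++⁻ʳ Q₁ oks)
  Q₁<c : All (λ B → topValue B < value c) Q₁
  Q₁<c = All.map (λ B<P → subst (_ <_) (topValue-∷ʳ A c) (proj₁ (All.head B<P))) (proj₂ (proj₂ (allPairs-++⁻ Q₁ lefts)))
  distinct : AllPairs (λ a b → time a ≢ time b) (concat Q₁ ++ P ++ concat Q₂)
  distinct = subst (AllPairs _) (concat-middle Q₁ P Q₂) (times-distinct Q↭)
  crossP : All (λ p → All (λ e → time p ≢ time e) (concat Q₂)) P
  crossP = proj₂ (proj₂ (allPairs-++⁻ P (proj₁ (proj₂ (allPairs-++⁻ (concat Q₁) distinct)))))
  later : ∀ {b} → b ∈ Q₂ → All (λ e → time e < time c) b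
  later b∈ = All.zipWith (λ (e≤c , e≢c) → ≤∧≢⇒< e≤c (e≢c ∘ sym))
    (All.lookup (All.tail (All.++⁻ʳ Q₁ (All.concat⁻ (times-bounded Q↭)))) b∈ ,
     All.lookup (All.concat⁻ (All.lookup crossP (∈-++⁺ʳ A (here refl)))) b∈)

-- Positions increase up a pile, so the card with the last position is the top of its pile.
predecessor-exists : ∀ k Q → Valid Q → map time (concat Q) ↭ [1… suc k ] → ∃[ x ] Predecessor k (x , suc k) Q
predecessor-exists k Q valid@(oks , _) Q↭ with ∈-map⁻ time (∈-resp-↭ (↭-sym Q↭) last∈)
  where last∈ = subst (suc k ∈_) (sym ([1…]-∷ʳ k)) (∈-++⁺ʳ [1… k ] (here refl))
... | (x , _) , c∈ , refl with ∈-concat⁻′ Q c∈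
... | P , c∈P , P∈Q with ∈-∃++ P∈Q | ∈-∃++ c∈P
... | Q₁ , Q₂ , refl | []    , []    , refl = x , remove-singleton-pile k Q₁ x Q₂ valid Q↭
... | Q₁ , Q₂ , refl | a ∷ A , []    , refl = x , remove-top-card k Q₁ (a ∷ A) x Q₂ (λ ()) valid Q↭
... | Q₁ , Q₂ , refl | A     , b ∷ B , refl
  with proj₁ (proj₂ (allPairs-++⁻ A (proj₂ (All.head (All.++⁻ʳ Q₁ oks)))))
     | All.head (All.++⁻ʳ Q₁ (All.concat⁻ (times-bounded Q↭)))
...   | ((_ , c<b) ∷ _) ∷ _ | bounded =
  ⊥-elim (<-irrefl refl (<-≤-trans c<b (All.lookup bounded (∈-++⁺ʳ A (there (here refl))))))

valid-surjective : ∀ m Q → Valid Q → map time (concat Q) ↭ [1… m ] → ∃[ σ ] patience σ ≡ Q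
valid-surjective zero    []            _                _  = [] , refl
valid-surjective zero    ([] ∷ Q)      ((P≢[] , _) ∷ _ , _) _ = ⊥-elim (P≢[] refl)
valid-surjective zero    ((e ∷ P) ∷ Q) _                Q↭ with () ← ↭-empty-inv Q↭
valid-surjective (suc k) Q             valid           Q↭ with predecessor-exists k Q valid Q↭
... | x , Q′ , valid′ , Q′↭ , inserted with valid-surjective k Q′ valid′ Q′↭
... | σ′ , dealt = σ′ ∷ʳ x , (begin
  patience (σ′ ∷ʳ x)                         ≡⟨ patience-∷ʳ σ′ x ⟩
  insert (x , suc (length σ′)) (patience σ′) ≡⟨ cong₂ (λ n → insert (x , suc n)) length≡ dealt ⟩
  insert (x , suc k) Q′                      ≡⟨ inserted ⟩
  Q                                          ∎)
  where
  open ≡-Reasoning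
  length≡ : length σ′ ≡ k
  length≡ = begin
    length σ′                              ≡⟨ length-[1…] (length σ′) ⟨
    length [1… length σ′ ]                 ≡⟨ ↭-length (patience-times σ′) ⟨
    length (map time (concat (patience σ′))) ≡⟨ cong (length ∘ map time ∘ concat) dealt ⟩
    length (map time (concat Q′))           ≡⟨ ↭-length Q′↭ ⟩
    length [1… k ]                          ≡⟨ length-[1…] k ⟩
    k                                       ∎

cards-InΣ : ∀ {n Rc Sc} → InΣ n Rc Sc → let Q = cards Rc Sc in
  Valid Q × map value (concat Q) ↭ [1… n ] × map time (concat Q) ↭ [1… n ]
cards-InΣ {n} {Rc} {Sc} (Rconf , Sconf , sh≡ , av₁ , _ , av₃) = valid , values↭ , times↭
  where
  Q  = cards Rc Sc
  R≡ = insertionPiles-cards Rc Sc sh≡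
  S≡ = recordingPiles-cards Rc Sc sh≡
  avoiding : ∀ {p q} → Avoids p q (RPW Rc) (RPW′ Sc) → Avoiding (Matches p q) (concat Q)
  avoiding {p} {q} av =
    pileWords-avoid⇒avoiding p q Q (subst₂ (λ Rc Sc → Avoids p q (RPW Rc) (RPW′ Sc)) (sym R≡) (sym S≡) av)
  values↭ : map value (concat Q) ↭ [1… n ]
  values↭ = begin
    map value (concat Q)           ≡⟨ RPW-insertionPiles Q ⟨
    concat (insertionPiles Q)      ≡⟨ cong concat R≡ ⟩
    concat Rc                      ↭⟨ proj₂ (isPileConf⇒legal Rconf) ⟩
    [1… n ]                        ∎
    where open PermutationReasoning
  times↭ : map time (concat Q) ↭ [1… n ]
  times↭ = begin
    map time (concat Q)            ↭⟨ concat-recordingPiles Q ⟨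
    concat (recordingPiles Q)      ≡⟨ cong concat S≡ ⟩
    concat Sc                      ↭⟨ proj₂ (isPileConf⇒legal Sconf) ⟩
    [1… n ]                        ∎
    where open PermutationReasoning
  valid : Valid Q
  valid = legal⇒valid Q
    (subst LegalPiles (sym R≡) (proj₁ (isPileConf⇒legal Rconf)))
    (subst LegalPiles (sym S≡) (proj₁ (isPileConf⇒legal Sconf)))
    (AllPairs.map⁻ (unique-resp-↭ (↭-sym values↭) (unique-[1…] n)))
    (avoiding av₁) (avoiding av₃)

Σ-surjective : ∀ n Rc Sc → InΣ n Rc Sc → ∃[ σ ] IsPerm n σ × (R σ , S σ) ≡ (Rc , Sc)
Σ-surjective n Rc Sc inΣ@(_ , _ , sh≡ , _) with cards-InΣ inΣ
... | valid , values↭ , times↭ with valid-surjective n (cards Rc Sc) valid times↭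
... | σ , dealt =
  σ , ↭-trans (↭-sym (patience-values σ)) (subst (λ Q → map value (concat Q) ↭ [1… n ]) (sym dealt) values↭) ,
  cong₂ _,_ (trans (R-patience σ) (trans (cong insertionPiles dealt) (insertionPiles-cards Rc Sc sh≡)))
            (trans (S-patience σ) (trans (cong recordingPiles dealt) (recordingPiles-cards Rc Sc sh≡)))

mainTheorem4 : (n : ℕ)
    → ((σ : List ℕ) → IsPerm n σ → InΣ n (R σ) (S σ))
    × ((σ τ : List ℕ) → IsPerm n σ → IsPerm n τ → (R σ , S σ) ≡ (R τ , S τ) → σ ≡ τ)
    × ((Rc Sc : PileConf) → InΣ n Rc Sc → ∃[ σ ] (IsPerm n σ × (R σ , S σ) ≡ (Rc , Sc)))
mainTheorem4 n = patience-inΣ n , RS-injective n , Σ-surjective n
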